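{- Let $(\mathcal{R},\ast,+)$ be a commutative ring, $\tau:\mathcal{R}\to\mathcal{R}$ an involutive ring homomorphism, $\mathcal{R}^\pm$ the $\pm1$-eigenspaces of $\tau$, and put $[f_1,f_2]^\ast:=(\tau f_1)\ast f_2-f_1\ast(\tau f_2)$ and $f_1\star^-f_2:=(f_1-\tau f_1)\ast(f_2-\tau f_2)$. For $V\in\mathcal{R}$ define $\mathrm{d}^+_V:=[(\mathrm{id}-\tau)V,\cdot]^\ast$ and $\mathrm{d}^-_Vf:=V\star^-f$. Then: $\mathrm{d}^+_V$ is an inner derivation of $[\cdot,\cdot]^\ast$; $\mathrm{d}^-_V(f\ast g)=(\mathrm{d}^-_Vf)\ast g+(\tau f)\ast\mathrm{d}^-_Vg$; $\mathrm{d}^\pm_{V_1}\circ\mathrm{d}^\pm_{V_2}=0$ for all $V_1,V_2\in\mathcal{R}$; $\mathcal{R}^\mp\subset\ker(\mathrm{d}^\pm_V)$; and the product rule $\mathrm{d}^\pm_{V_1\ast V_2}f=V_1\ast\mathrm{d}^\pm_{V_2}f+(\tau V_2)\ast\mathrm{d}^\pm_{V_1}f$ holds, so that $\ker(\mathrm{d}^\pm_{V_1})\cap\ker(\mathrm{d}^\pm_{V_2})\subset\ker(\mathrm{d}^\pm_{V_1\ast V_2})$. -}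

module Defs where

open import Level using (_⊔_)
open import Algebra.Bundles using (CommutativeRing)
open import Algebra.Morphism.Structures using (module RingMorphisms)
open import Data.Product using (_×_; ∃)

module _ {c ℓ} (R : CommutativeRing c ℓ) where
  open CommutativeRing R
  open RingMorphisms rawRing rawRing using (IsRingHomomorphism)

  IsInvolutiveRingHom : (Carrier → Carrier) → Set (c ⊔ ℓ)
  IsInvolutiveRingHom τ = IsRingHomomorphism τ × (∀ x → τ (τ x) ≈ x)

  module _ (τ : Carrier → Carrier) where

    bracket* : Carrier → Carrier → Carrier
    bracket* f₁ f₂ = τ f₁ * f₂ - f₁ * τ f₂

    star⁻ : Carrier → Carrier → Carrier
    star⁻ f₁ f₂ = (f₁ - τ f₁) * (f₂ - τ f₂)

    d⁺ : Carrier → Carrier → Carrier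
    d⁺ V f = bracket* (V - τ V) f

    d⁻ : Carrier → Carrier → Carrier
    d⁻ V f = star⁻ V f

    IsDerivation : (Carrier → Carrier) → Set (c ⊔ ℓ)
    IsDerivation d = ∀ f g → d (bracket* f g) ≈ bracket* (d f) g + bracket* f (d g)

    IsInnerDerivation : (Carrier → Carrier) → Set (c ⊔ ℓ)
    IsInnerDerivation d = (∃ λ W → ∀ f → d f ≈ bracket* W f) × IsDerivation d

    InR⁺ : Carrier → Set ℓ
    InR⁺ f = τ f ≈ f

    InR⁻ : Carrier → Set ℓ
    InR⁻ f = τ f ≈ - f

    InKer : (Carrier → Carrier) → Carrier → Set ℓ
    InKer d f = d f ≈ 0#

-- Write odd x = x - τ x and even x = x + τ x. For w ∈ R⁻ the bracket collapses to
-- [w , f]* = - w * even f and [f , w]* = even f * w, and since d⁺_V = [odd V , ·]*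
-- and d⁻_V f = odd V * odd f, both operators are "odd V times something". Everything
-- then follows from three observations: odd is a τ-twisted derivation,
-- odd (x * y) = x * odd y + τ y * odd x, which gives all product rules; d⁺ lands in
-- R⁻ (every bracket does) and kills R⁻ (even vanishes there); d⁻ lands in R⁺ (a
-- product of two elements of R⁻) and kills R⁺ (odd vanishes there).
module Submission where

open import Defs
open import Algebra.Bundles using (CommutativeRing)
open import Data.Product using (_×_; _,_; proj₁; proj₂)
import Algebra.Properties.Ring as RingProperties
import Algebra.Properties.CommutativeSemigroup as CommutativeSemigroupProperties
import Relation.Binary.Reasoning.Setoid as SetoidReasoning
open import Algebra.Morphism.Structures using (module RingMorphisms)

module InvolutiveRing {c ℓ} (R : CommutativeRing c ℓ)
  (τ : CommutativeRing.Carrier R → CommutativeRing.Carrier R)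
  (τ-isInvolutiveRingHom : IsInvolutiveRingHom R τ) where

  open CommutativeRing R
  open RingProperties ring using (-‿distribˡ-*; -‿distribʳ-*; -‿involutive; -0#≈0#; ⁻¹-anti-homo‿-; -‿+-comm; x[y-z]≈xy-xz)
  open CommutativeSemigroupProperties *-commutativeSemigroup using (x∙yz≈y∙xz)
  open SetoidReasoning setoid
  open RingMorphisms.IsRingHomomorphism (proj₁ τ-isInvolutiveRingHom)
    using () renaming (⟦⟧-cong to τ-cong; +-homo to τ-+; *-homo to τ-*; -‿homo to τ-‿)

  τ-involutive : ∀ x → τ (τ x) ≈ x
  τ-involutive = proj₂ τ-isInvolutiveRingHom

  τ-sub : ∀ x y → τ (x - y) ≈ τ x - τ y
  τ-sub x y = trans (τ-+ x (- y)) (+-congˡ (τ-‿ y))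

  -- Twice the odd and even parts; no division by 2 is needed.
  odd : Carrier → Carrier
  odd x = x - τ x

  even : Carrier → Carrier
  even x = x + τ x

  odd-cong : ∀ {x y} → x ≈ y → odd x ≈ odd y
  odd-cong x≈y = +-cong x≈y (-‿cong (τ-cong x≈y))

  odd-InR⁻ : ∀ x → InR⁻ R τ (odd x)
  odd-InR⁻ x = begin
    τ (x - τ x)     ≈⟨ τ-sub x (τ x) ⟩
    τ x - τ (τ x)   ≈⟨ +-congˡ (-‿cong (τ-involutive x)) ⟩
    τ x - x         ≈⟨ ⁻¹-anti-homo‿- x (τ x) ⟨
    - (x - τ x)     ∎

  InR⁺⇒odd≈0 : ∀ {f} → InR⁺ R τ f → odd f ≈ 0#
  InR⁺⇒odd≈0 {f} τf≈f = trans (+-congˡ (-‿cong τf≈f)) (-‿inverseʳ f)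

  InR⁻⇒even≈0 : ∀ {f} → InR⁻ R τ f → even f ≈ 0#
  InR⁻⇒even≈0 {f} τf≈-f = trans (+-congˡ τf≈-f) (-‿inverseʳ f)

  bracket*-InR⁻ : ∀ x y → InR⁻ R τ (bracket* R τ x y)
  bracket*-InR⁻ x y = begin
    τ (τ x * y - x * τ y)          ≈⟨ τ-sub (τ x * y) (x * τ y) ⟩
    τ (τ x * y) - τ (x * τ y)      ≈⟨ +-cong (τ-* (τ x) y) (-‿cong (τ-* x (τ y))) ⟩
    τ (τ x) * τ y - τ x * τ (τ y)  ≈⟨ +-cong (*-congʳ (τ-involutive x)) (-‿cong (*-congˡ (τ-involutive y))) ⟩
    x * τ y - τ x * y              ≈⟨ ⁻¹-anti-homo‿- (τ x * y) (x * τ y) ⟨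
    - (τ x * y - x * τ y)          ∎

  -x*-y≈x*y : ∀ x y → - x * - y ≈ x * y
  -x*-y≈x*y x y = begin
    - x * - y      ≈⟨ -‿distribˡ-* x (- y) ⟨
    - (x * - y)    ≈⟨ -‿cong (-‿distribʳ-* x y) ⟨
    - (- (x * y))  ≈⟨ -‿involutive (x * y) ⟩
    x * y          ∎

  *-InR⁻⇒InR⁺ : ∀ {x y} → InR⁻ R τ x → InR⁻ R τ y → InR⁺ R τ (x * y)
  *-InR⁻⇒InR⁺ {x} {y} τx≈-x τy≈-y = begin
    τ (x * y)   ≈⟨ τ-* x y ⟩
    τ x * τ y   ≈⟨ *-cong τx≈-x τy≈-y ⟩
    - x * - y   ≈⟨ -x*-y≈x*y x y ⟩
    x * y       ∎

  bracket*-InR⁻ˡ : ∀ {w} f → InR⁻ R τ w → bracket* R τ w f ≈ - (w * even f)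
  bracket*-InR⁻ˡ {w} f τw≈-w = begin
    τ w * f - w * τ f          ≈⟨ +-congʳ (*-congʳ τw≈-w) ⟩
    - w * f - w * τ f          ≈⟨ +-congʳ (-‿distribˡ-* w f) ⟨
    - (w * f) - w * τ f        ≈⟨ -‿+-comm (w * f) (w * τ f) ⟩
    - (w * f + w * τ f)        ≈⟨ -‿cong (distribˡ w f (τ f)) ⟨
    - (w * even f)             ∎

  bracket*-InR⁻ʳ : ∀ f {v} → InR⁻ R τ v → bracket* R τ f v ≈ even f * v
  bracket*-InR⁻ʳ f {v} τv≈-v = begin
    τ f * v - f * τ v          ≈⟨ +-congˡ (-‿cong (*-congˡ τv≈-v)) ⟩
    τ f * v - f * - v          ≈⟨ +-congˡ (-‿cong (-‿distribʳ-* f v)) ⟨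
    τ f * v - - (f * v)        ≈⟨ +-congˡ (-‿involutive (f * v)) ⟩
    τ f * v + f * v            ≈⟨ +-comm (τ f * v) (f * v) ⟩
    f * v + τ f * v            ≈⟨ distribʳ v f (τ f) ⟨
    even f * v                 ∎

  -- Inner derivations of [·,·]* by elements of R⁻ are identically zero on brackets,
  -- and the two terms of the Leibniz expansion cancel.
  bracket*-isDerivation : ∀ {w} → InR⁻ R τ w → IsDerivation R τ (bracket* R τ w)
  bracket*-isDerivation {w} w∈R⁻ f g = begin
    bracket* R τ w (bracket* R τ f g)         ≈⟨ bracket*-InR⁻ˡ (bracket* R τ f g) w∈R⁻ ⟩
    - (w * even (bracket* R τ f g))           ≈⟨ -‿cong (*-congˡ (InR⁻⇒even≈0 (bracket*-InR⁻ f g))) ⟩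
    - (w * 0#)                                ≈⟨ -‿cong (zeroʳ w) ⟩
    - 0#                                      ≈⟨ -0#≈0# ⟩
    0#                                        ≈⟨ -‿inverseˡ (even f * [w,g]) ⟨
    - (even f * [w,g]) + even f * [w,g]       ≈⟨ +-congʳ (-‿cong swap) ⟨
    - ([w,f] * even g) + even f * [w,g]       ≈⟨ +-cong (bracket*-InR⁻ˡ g (bracket*-InR⁻ w f)) (bracket*-InR⁻ʳ f (bracket*-InR⁻ w g)) ⟨
    bracket* R τ [w,f] g + bracket* R τ f [w,g] ∎
    where
    [w,f] [w,g] : Carrier
    [w,f] = bracket* R τ w f
    [w,g] = bracket* R τ w g

    swap : [w,f] * even g ≈ even f * [w,g]
    swap = begin
      [w,f] * even g               ≈⟨ *-congʳ (bracket*-InR⁻ˡ f w∈R⁻) ⟩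
      - (w * even f) * even g      ≈⟨ -‿distribˡ-* (w * even f) (even g) ⟨
      - (w * even f * even g)      ≈⟨ -‿cong (*-congʳ (*-comm w (even f))) ⟩
      - (even f * w * even g)      ≈⟨ -‿cong (*-assoc (even f) w (even g)) ⟩
      - (even f * (w * even g))    ≈⟨ -‿distribʳ-* (even f) (w * even g) ⟩
      even f * - (w * even g)      ≈⟨ *-congˡ (bracket*-InR⁻ˡ g w∈R⁻) ⟨
      even f * [w,g]               ∎

  odd-* : ∀ x y → odd (x * y) ≈ x * odd y + τ y * odd x
  odd-* x y = begin
    x * y - τ (x * y)                          ≈⟨ +-congˡ (-‿cong (τ-* x y)) ⟩
    x * y - τ x * τ y                          ≈⟨ telescope (x * y) (x * τ y) (τ x * τ y) ⟨
    (x * y - x * τ y) + (x * τ y - τ x * τ y)  ≈⟨ +-congˡ (+-cong (*-comm x (τ y)) (-‿cong (*-comm (τ x) (τ y)))) ⟩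
    (x * y - x * τ y) + (τ y * x - τ y * τ x)  ≈⟨ +-cong (x[y-z]≈xy-xz x y (τ y)) (x[y-z]≈xy-xz (τ y) x (τ x)) ⟨
    x * odd y + τ y * odd x                    ∎
    where
    telescope : ∀ a b c → (a - b) + (b - c) ≈ a - c
    telescope a b c = begin
      (a - b) + (b - c)    ≈⟨ +-assoc a (- b) (b - c) ⟩
      a + (- b + (b - c))  ≈⟨ +-congˡ (+-assoc (- b) b (- c)) ⟨
      a + ((- b + b) - c)  ≈⟨ +-congˡ (+-congʳ (-‿inverseˡ b)) ⟩
      a + (0# - c)         ≈⟨ +-congˡ (+-identityˡ (- c)) ⟩
      a - c                ∎

  odd-*′ : ∀ x y → odd (x * y) ≈ odd x * y + τ x * odd y
  odd-*′ x y = begin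
    odd (x * y)               ≈⟨ odd-cong (*-comm x y) ⟩
    odd (y * x)               ≈⟨ odd-* y x ⟩
    y * odd x + τ x * odd y   ≈⟨ +-congʳ (*-comm y (odd x)) ⟩
    odd x * y + τ x * odd y   ∎

  odd-*-productRule : ∀ V₁ V₂ g → odd (V₁ * V₂) * g ≈ V₁ * (odd V₂ * g) + τ V₂ * (odd V₁ * g)
  odd-*-productRule V₁ V₂ g = begin
    odd (V₁ * V₂) * g                           ≈⟨ *-congʳ (odd-* V₁ V₂) ⟩
    (V₁ * odd V₂ + τ V₂ * odd V₁) * g           ≈⟨ distribʳ g (V₁ * odd V₂) (τ V₂ * odd V₁) ⟩
    V₁ * odd V₂ * g + τ V₂ * odd V₁ * g         ≈⟨ +-cong (*-assoc V₁ (odd V₂) g) (*-assoc (τ V₂) (odd V₁) g) ⟩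
    V₁ * (odd V₂ * g) + τ V₂ * (odd V₁ * g)     ∎

  d⁺≈odd*-even : ∀ V f → d⁺ R τ V f ≈ odd V * - even f
  d⁺≈odd*-even V f = trans (bracket*-InR⁻ˡ f (odd-InR⁻ V)) (-‿distribʳ-* (odd V) (even f))

  d⁺-isInnerDerivation : ∀ V → IsInnerDerivation R τ (d⁺ R τ V)
  d⁺-isInnerDerivation V = (odd V , λ f → refl) , bracket*-isDerivation (odd-InR⁻ V)

  d⁻-twistedLeibniz : ∀ V f g → d⁻ R τ V (f * g) ≈ d⁻ R τ V f * g + τ f * d⁻ R τ V g
  d⁻-twistedLeibniz V f g = begin
    odd V * odd (f * g)                          ≈⟨ *-congˡ (odd-*′ f g) ⟩
    odd V * (odd f * g + τ f * odd g)            ≈⟨ distribˡ (odd V) (odd f * g) (τ f * odd g) ⟩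
    odd V * (odd f * g) + odd V * (τ f * odd g)  ≈⟨ +-cong (*-assoc (odd V) (odd f) g) (x∙yz≈y∙xz (τ f) (odd V) (odd g)) ⟨
    odd V * odd f * g + τ f * (odd V * odd g)    ∎

  d⁺-InR⁻ : ∀ V f → InR⁻ R τ f → InKer R τ (d⁺ R τ V) f
  d⁺-InR⁻ V f f∈R⁻ = begin
    d⁺ R τ V f         ≈⟨ d⁺≈odd*-even V f ⟩
    odd V * - even f   ≈⟨ *-congˡ (-‿cong (InR⁻⇒even≈0 f∈R⁻)) ⟩
    odd V * - 0#       ≈⟨ *-congˡ -0#≈0# ⟩
    odd V * 0#         ≈⟨ zeroʳ (odd V) ⟩
    0#                 ∎

  d⁻-InR⁺ : ∀ V f → InR⁺ R τ f → InKer R τ (d⁻ R τ V) f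
  d⁻-InR⁺ V f f∈R⁺ = trans (*-congˡ (InR⁺⇒odd≈0 f∈R⁺)) (zeroʳ (odd V))

  d⁺∘d⁺≈0 : ∀ V₁ V₂ f → d⁺ R τ V₁ (d⁺ R τ V₂ f) ≈ 0#
  d⁺∘d⁺≈0 V₁ V₂ f = d⁺-InR⁻ V₁ _ (bracket*-InR⁻ (odd V₂) f)

  d⁻∘d⁻≈0 : ∀ V₁ V₂ f → d⁻ R τ V₁ (d⁻ R τ V₂ f) ≈ 0#
  d⁻∘d⁻≈0 V₁ V₂ f = d⁻-InR⁺ V₁ _ (*-InR⁻⇒InR⁺ (odd-InR⁻ V₂) (odd-InR⁻ f))

  d⁺-productRule : ∀ V₁ V₂ f → d⁺ R τ (V₁ * V₂) f ≈ V₁ * d⁺ R τ V₂ f + τ V₂ * d⁺ R τ V₁ f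
  d⁺-productRule V₁ V₂ f = begin
    d⁺ R τ (V₁ * V₂) f                            ≈⟨ d⁺≈odd*-even (V₁ * V₂) f ⟩
    odd (V₁ * V₂) * - even f                      ≈⟨ odd-*-productRule V₁ V₂ (- even f) ⟩
    V₁ * (odd V₂ * - even f) + τ V₂ * (odd V₁ * - even f)
      ≈⟨ +-cong (*-congˡ (d⁺≈odd*-even V₂ f)) (*-congˡ (d⁺≈odd*-even V₁ f)) ⟨
    V₁ * d⁺ R τ V₂ f + τ V₂ * d⁺ R τ V₁ f         ∎

  d⁻-productRule : ∀ V₁ V₂ f → d⁻ R τ (V₁ * V₂) f ≈ V₁ * d⁻ R τ V₂ f + τ V₂ * d⁻ R τ V₁ f
  d⁻-productRule V₁ V₂ f = odd-*-productRule V₁ V₂ (odd f)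

  productRule⇒ker-* : (d : Carrier → Carrier → Carrier) →
    (∀ V₁ V₂ f → d (V₁ * V₂) f ≈ V₁ * d V₂ f + τ V₂ * d V₁ f) →
    ∀ V₁ V₂ f → d V₁ f ≈ 0# → d V₂ f ≈ 0# → d (V₁ * V₂) f ≈ 0#
  productRule⇒ker-* d productRule V₁ V₂ f dV₁f≈0 dV₂f≈0 = begin
    d (V₁ * V₂) f                ≈⟨ productRule V₁ V₂ f ⟩
    V₁ * d V₂ f + τ V₂ * d V₁ f  ≈⟨ +-cong (*-congˡ dV₂f≈0) (*-congˡ dV₁f≈0) ⟩
    V₁ * 0# + τ V₂ * 0#          ≈⟨ +-cong (zeroʳ V₁) (zeroʳ (τ V₂)) ⟩
    0# + 0#                      ≈⟨ +-identityˡ 0# ⟩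
    0#                           ∎

mainTheorem17 : ∀ {c ℓ} (R : CommutativeRing c ℓ) (τ : CommutativeRing.Carrier R → CommutativeRing.Carrier R) →
    IsInvolutiveRingHom R τ →
    let open CommutativeRing R in
    -- d⁺_V is an inner derivation of [·,·]*
    (∀ V → IsInnerDerivation R τ (d⁺ R τ V))
    -- twisted Leibniz rule for d⁻_V
    × (∀ V f g → d⁻ R τ V (f * g) ≈ d⁻ R τ V f * g + τ f * d⁻ R τ V g)
    -- d^± ∘ d^± = 0
    × (∀ V₁ V₂ f → d⁺ R τ V₁ (d⁺ R τ V₂ f) ≈ 0#)
    × (∀ V₁ V₂ f → d⁻ R τ V₁ (d⁻ R τ V₂ f) ≈ 0#)
    -- R^∓ ⊆ ker d^±
    × (∀ V f → InR⁻ R τ f → InKer R τ (d⁺ R τ V) f)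
    × (∀ V f → InR⁺ R τ f → InKer R τ (d⁻ R τ V) f)
    -- product rules
    × (∀ V₁ V₂ f → d⁺ R τ (V₁ * V₂) f ≈ V₁ * d⁺ R τ V₂ f + τ V₂ * d⁺ R τ V₁ f)
    × (∀ V₁ V₂ f → d⁻ R τ (V₁ * V₂) f ≈ V₁ * d⁻ R τ V₂ f + τ V₂ * d⁻ R τ V₁ f)
    -- kernel intersections
    × (∀ V₁ V₂ f → InKer R τ (d⁺ R τ V₁) f → InKer R τ (d⁺ R τ V₂) f → InKer R τ (d⁺ R τ (V₁ * V₂)) f)
    × (∀ V₁ V₂ f → InKer R τ (d⁻ R τ V₁) f → InKer R τ (d⁻ R τ V₂) f → InKer R τ (d⁻ R τ (V₁ * V₂)) f)
mainTheorem17 R τ τ-isInvolutiveRingHom =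
    d⁺-isInnerDerivation
  , d⁻-twistedLeibniz
  , d⁺∘d⁺≈0
  , d⁻∘d⁻≈0
  , d⁺-InR⁻
  , d⁻-InR⁺
  , d⁺-productRule
  , d⁻-productRule
  , productRule⇒ker-* (d⁺ R τ) d⁺-productRule
  , productRule⇒ker-* (d⁻ R τ) d⁻-productRule
  where open InvolutiveRing R τ τ-isInvolutiveRingHom
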